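{- For every integer $q\ge 3$, the graph $\overline{ME^*_q}$ is $C_4$-free.
   Context: For $q\ge 2$, $\overline{ME_q}$ is the graph with the $4q+2$ vertices $u_0,u_1,\dots,u_{q+1}$ and $v_{i1},v_{i2},v_{i3}$ ($i=1,\dots,q$), whose edges are: the edges of the Hamiltonian cycle $u_0,u_1,\dots,u_{q+1},v_{11},v_{12},v_{13},v_{21},v_{22},v_{23},\dots,v_{q1},v_{q2},v_{q3},u_0$; the edges $u_iv_{i2}$ for $i=1,\dots,q$; and the edges $v_{i1}v_{i3}$ for $i=1,\dots,q$. $\overline{ME^*_q}$ is obtained from $\overline{ME_q}$ by adding the edge $u_0u_{q+1}$. A graph is $C_4$-free if it has no induced subgraph that is a cycle on four vertices. -}

module Defs where

open import Data.Nat using (ℕ; zero; suc; _+_; _*_; _∸_; _<_; _≤_)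
open import Data.Sum using (_⊎_)
open import Relation.Binary.PropositionalEquality using (_≡_)
open import Relation.Nullary using (¬_)

-- Vertices of ME*_q are encoded as the naturals 0 .. 4q+1, numbered along
-- the Hamiltonian cycle  u_0,u_1,…,u_{q+1},v_{11},v_{12},v_{13},…,v_{q1},v_{q2},v_{q3}.

order : ℕ → ℕ
order q = 4 * q + 2

u : ℕ → ℕ → ℕ
u q i = i

v : ℕ → ℕ → ℕ → ℕ
v q i j = (q + 2) + 3 * (i ∸ 1) + (j ∸ 1)

data Edge (q : ℕ) : ℕ → ℕ → Set where
  cyc   : ∀ k → suc k < order q → Edge q k (suc k)
  close : Edge q (v q q 3) (u q 0)
  spoke : ∀ i → 1 ≤ i → i ≤ q → Edge q (u q i) (v q i 2)
  chord : ∀ i → 1 ≤ i → i ≤ q → Edge q (v q i 1) (v q i 3)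
  extra : Edge q (u q 0) (u q (suc q))

Adj : ℕ → ℕ → ℕ → Set
Adj q a b = Edge q a b ⊎ Edge q b a

record InducedC4 (q : ℕ) : Set where
  field
    a b c d : ℕ
    a< : a < order q
    b< : b < order q
    c< : c < order q
    d< : d < order q
    a≢b : ¬ a ≡ b
    a≢c : ¬ a ≡ c
    a≢d : ¬ a ≡ d
    b≢c : ¬ b ≡ c
    b≢d : ¬ b ≡ d
    c≢d : ¬ c ≡ d
    ab : Adj q a b
    bc : Adj q b c
    cd : Adj q c d
    da : Adj q d a
    ¬ac : ¬ Adj q a c
    ¬bd : ¬ Adj q b d

C4-free : ℕ → Set
C4-free q = ¬ InducedC4 q

-- A vertex v_ij lies in the triangle v_i1 v_i2 v_i3 and has exactly one neighbour outside it
-- (u_i, or its neighbour on the Hamiltonian cycle), and for q ≥ 2 the three outer neighbours of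
-- a triangle are pairwise non-adjacent.  On an induced 4-cycle a b c d through a = v_ij the
-- non-adjacent neighbours b, d of a must be a triangle mate and the outer neighbour of a; then c,
-- a neighbour of the mate that is not adjacent to a, is the outer neighbour of the mate, and it
-- is adjacent to d: impossible.  So an induced 4-cycle avoids the triangles, but u_0, …, u_{q+1}
-- induce a cycle of length q + 2 ≥ 5, which has no 4-cycle at all.  The argument runs on a copy
-- of the graph with structured vertices, into which the numbered vertices 0, …, 4q+1 embed.
module Submission where

open import Defs

open import Data.Empty using (⊥)
open import Data.Fin as Fin using (Fin; toℕ)
open import Data.Fin.Patterns using (0F; 1F; 2F)
open import Data.Fin.Properties using (toℕ<n; toℕ-fromℕ<; toℕ-injective)
open import Data.Nat using (ℕ; zero; suc; _+_; _*_; _∸_; _≤_; _<_; z≤n; s≤s; _≤?_)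
open import Data.Nat.DivMod
  using (_/_; _%_; _mod_; _divMod_; DivMod; +-distrib-/-∣ˡ; m*n/n≡m; m<n⇒m/n≡0; %-remove-+ˡ; m<n⇒m%n≡m; m<n*o⇒m/o<n)
open import Data.Nat.Divisibility using (_∣_; m∣m*n)
open import Data.Nat.Properties
  using (≤-refl; ≤-trans; <-trans; <-irrefl; <⇒≤; <⇒≱; ≰⇒>; n<1+n; m≤n⇒m≤1+n; m≤n⇒m<n∨m≡n; m≤m+n; m≤n*m;
         +-comm; +-assoc; +-suc; +-identityʳ; *-comm; m+[n∸m]≡n; m+n∸m≡n; m+n∸n≡m;
         ∸-monoˡ-<; +-monoˡ-≤; +-monoʳ-≤; +-monoʳ-<; *-monoʳ-≤; module ≤-Reasoning)
open import Data.Nat.Tactic.RingSolver using (solve-∀)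
open import Data.Product using (∃-syntax; _×_; _,_; proj₁; proj₂)
open import Data.Sum as Sum using (_⊎_; inj₁; inj₂)
open import Function.Base using (_∘_)
open import Function.Definitions using (Injective)
open import Relation.Binary.Definitions using (Symmetric; DecidableEquality)
open import Relation.Binary.PropositionalEquality
  using (_≡_; _≢_; refl; sym; trans; cong; cong₂; subst; subst₂; ≢-sym; module ≡-Reasoning)
open import Relation.Nullary using (¬_; yes; no; contradiction)

private variable
  A B I : Set
  a b c d : A

-- Four-cycles in an arbitrary graph

module _ (_~_ : A → A → Set) where

  record FourCycle (a b c d : A) : Set where
    constructor four-cycle
    field
      ab : a ~ b
      bc : b ~ c
      cd : c ~ d
      da : d ~ a
      a≢c : a ≢ c
      b≢d : b ≢ d

  record InducedFourCycle (a b c d : A) : Set where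
    constructor induced
    field
      cycle : FourCycle a b c d
      a≁c : ¬ a ~ c
      b≁d : ¬ b ~ d

module _ {_~_ : A → A → Set} where

  rotate : FourCycle _~_ a b c d → FourCycle _~_ b c d a
  rotate (four-cycle ab bc cd da a≢c b≢d) = four-cycle bc cd da ab b≢d (≢-sym a≢c)

  module _ (~-sym : Symmetric _~_) where

    reverse : FourCycle _~_ a b c d → FourCycle _~_ b a d c
    reverse (four-cycle ab bc cd da a≢c b≢d) =
      four-cycle (~-sym ab) (~-sym da) (~-sym cd) (~-sym bc) b≢d a≢c

    rotate-induced : InducedFourCycle _~_ a b c d → InducedFourCycle _~_ b c d a
    rotate-induced (induced cycle a≁c b≁d) = induced (rotate cycle) b≁d (a≁c ∘ ~-sym)

module _ {_~_ : A → A → Set} {_≈_ : B → B → Set} (f : A → B) where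

  preimage : (∀ {x y} → f x ≈ f y → x ~ y) →
             FourCycle _≈_ (f a) (f b) (f c) (f d) → FourCycle _~_ a b c d
  preimage reflects (four-cycle ab bc cd da a≢c b≢d) =
    four-cycle (reflects ab) (reflects bc) (reflects cd) (reflects da) (a≢c ∘ cong f) (b≢d ∘ cong f)

  image : Injective _≡_ _≡_ f → (∀ {x y} → x ~ y → f x ≈ f y) → (∀ {x y} → f x ≈ f y → x ~ y) →
          InducedFourCycle _~_ a b c d → InducedFourCycle _≈_ (f a) (f b) (f c) (f d)
  image injective preserves reflects (induced (four-cycle ab bc cd da a≢c b≢d) a≁c b≁d) =
    induced (four-cycle (preserves ab) (preserves bc) (preserves cd) (preserves da)
                        (a≢c ∘ injective) (b≢d ∘ injective))
            (a≁c ∘ reflects) (b≁d ∘ reflects)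

module _ {_~_ : A → A → Set} (~-sym : Symmetric _~_)
         (_≟_ : DecidableEquality I) (clique : I → A) (Outer : I → A → Set)
         (clique-adjacent : ∀ {i j} → i ≢ j → clique i ~ clique j)
         (neighbour : ∀ {i x} → clique i ~ x → (∃[ j ] i ≢ j × x ≡ clique j) ⊎ Outer i x)
         (outer-unique : ∀ {i x y} → Outer i x → Outer i y → x ≡ y)
         (outers-nonadjacent : ∀ {i j x y} → i ≢ j → Outer i x → Outer j y → ¬ x ~ y) where

  private
    mate-then-outer : ∀ {i j} → i ≢ j → Outer i d → clique j ~ c → c ~ d →
                      clique i ≢ c → ¬ clique i ~ c → ⊥
    mate-then-outer {i = i} i≢j od bc cd a≢c a≁c with neighbour bc
    ... | inj₂ oc = outers-nonadjacent (≢-sym i≢j) oc od cd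
    ... | inj₁ (k , _ , refl) with i ≟ k
    ...   | yes refl = a≢c refl
    ...   | no i≢k   = a≁c (clique-adjacent i≢k)

  clique-not-on-induced-four-cycle : ∀ {i} → ¬ InducedFourCycle _~_ (clique i) b c d
  clique-not-on-induced-four-cycle (induced (four-cycle ab bc cd da a≢c b≢d) a≁c b≁d)
    with neighbour ab | neighbour (~-sym da)
  ... | inj₂ ob | inj₂ od = b≢d (outer-unique ob od)
  ... | inj₁ (_ , i≢j , refl) | inj₂ od = mate-then-outer i≢j od bc cd a≢c a≁c
  ... | inj₂ ob | inj₁ (_ , i≢k , refl) = mate-then-outer i≢k ob (~-sym cd) (~-sym bc) a≢c a≁c
  ... | inj₁ (j , _ , refl) | inj₁ (k , _ , refl) with j ≟ k
  ...   | yes refl = b≢d refl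
  ...   | no j≢k   = b≁d (clique-adjacent j≢k)

-- Cycles

data Consecutive : ℕ → ℕ → Set where
  up   : ∀ {n} → Consecutive n (suc n)
  down : ∀ {n} → Consecutive (suc n) n

-- The cycle 0 — 1 — ⋯ — N — 0, continued by the ray N — N+1 — ⋯, which costs nothing and
-- spares us the bounds.
data Cyclic (N : ℕ) : ℕ → ℕ → Set where
  step   : ∀ {m n} → Consecutive m n → Cyclic N m n
  wrap   : Cyclic N 0 N
  unwrap : Cyclic N N 0

Consecutive-sym : Symmetric Consecutive
Consecutive-sym up   = down
Consecutive-sym down = up

Cyclic-sym : ∀ {N} → Symmetric (Cyclic N)
Cyclic-sym (step s) = step (Consecutive-sym s)
Cyclic-sym wrap     = unwrap
Cyclic-sym unwrap   = wrap

path-four-cycle-free : ∀ {a b c d} → ¬ FourCycle Consecutive a b c d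
path-four-cycle-free (four-cycle up   up   up   () _ _)
path-four-cycle-free (four-cycle up   up   down _  _ b≢d) = b≢d refl
path-four-cycle-free (four-cycle up   down _    _  a≢c _) = a≢c refl
path-four-cycle-free (four-cycle down up   _    _  a≢c _) = a≢c refl
path-four-cycle-free (four-cycle down down up   _  _ b≢d) = b≢d refl
path-four-cycle-free (four-cycle down down down () _ _)

private
  wrap-not-on-four-cycle : ∀ {k c d} → ¬ FourCycle (Cyclic (4 + k)) 0 (4 + k) c d
  wrap-not-on-four-cycle (four-cycle _ _ _ unwrap _ b≢d) = b≢d refl
  wrap-not-on-four-cycle (four-cycle _ _ (step up) (step down) a≢c _) = a≢c refl
  wrap-not-on-four-cycle (four-cycle _ (step ()) (step down) (step down) _ _)

cycle-four-cycle-free : ∀ {N a b c d} → 4 ≤ N → ¬ FourCycle (Cyclic N) a b c d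
cycle-four-cycle-free (s≤s (s≤s (s≤s (s≤s _)))) sq
  with FourCycle.ab sq | FourCycle.bc sq | FourCycle.cd sq | FourCycle.da sq
... | wrap   | _      | _      | _      = wrap-not-on-four-cycle sq
... | unwrap | _      | _      | _      = wrap-not-on-four-cycle (reverse Cyclic-sym sq)
... | step _ | wrap   | _      | _      = wrap-not-on-four-cycle (rotate sq)
... | step _ | unwrap | _      | _      = wrap-not-on-four-cycle (reverse Cyclic-sym (rotate sq))
... | step _ | step _ | wrap   | _      = wrap-not-on-four-cycle (rotate (rotate sq))
... | step _ | step _ | unwrap | _      = wrap-not-on-four-cycle (reverse Cyclic-sym (rotate (rotate sq)))
... | step _ | step _ | step _ | wrap   = wrap-not-on-four-cycle (rotate (rotate (rotate sq)))
... | step _ | step _ | step _ | unwrap =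
  wrap-not-on-four-cycle (reverse Cyclic-sym (rotate (rotate (rotate sq))))
... | step s | step t | step r | step p =
  path-four-cycle-free (four-cycle s t r p (FourCycle.a≢c sq) (FourCycle.b≢d sq))

-- The graph ME*_q

-- U i is u_i and V m j is v_{(m+1)(j+1)}: triangles and their corners are counted from 0.
data Vertex : Set where
  U : ℕ → Vertex
  V : ℕ → Fin 3 → Vertex

data Link : ℕ → Vertex → Vertex → Set where
  ascend : ∀ {q i} → i ≤ q → Link q (U i) (U (suc i))
  enter  : ∀ {q} → 0 < q → Link q (U (suc q)) (V 0 0F)
  side₀₁ : ∀ {q m} → m < q → Link q (V m 0F) (V m 1F)
  side₁₂ : ∀ {q m} → m < q → Link q (V m 1F) (V m 2F)
  hop    : ∀ {q m} → suc m < q → Link q (V m 2F) (V (suc m) 0F)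
  leave  : ∀ {m} → Link (suc m) (V m 2F) (U 0)
  spoke  : ∀ {q m} → m < q → Link q (U (suc m)) (V m 1F)
  chord  : ∀ {q m} → m < q → Link q (V m 0F) (V m 2F)
  extra  : ∀ {q} → Link q (U 0) (U (suc q))

ME* : ℕ → Vertex → Vertex → Set
ME* q x y = Link q x y ⊎ Link q y x

ME*-sym : ∀ {q} → Symmetric (ME* q)
ME*-sym = Sum.swap

IsVertex : ℕ → Vertex → Set
IsVertex q (U i)   = i ≤ suc q
IsVertex q (V m _) = m < q

Link-endpoints : ∀ {q x y} → Link q x y → IsVertex q x × IsVertex q y
Link-endpoints (ascend i≤q) = m≤n⇒m≤1+n i≤q , s≤s i≤q
Link-endpoints (enter 0<q)  = ≤-refl , 0<q
Link-endpoints (side₀₁ m<q) = m<q , m<q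
Link-endpoints (side₁₂ m<q) = m<q , m<q
Link-endpoints (hop 1+m<q)  = <⇒≤ 1+m<q , 1+m<q
Link-endpoints leave        = ≤-refl , z≤n
Link-endpoints (spoke m<q)  = s≤s (<⇒≤ m<q) , m<q
Link-endpoints (chord m<q)  = m<q , m<q
Link-endpoints extra        = z≤n , ≤-refl

ME*-endpoint : ∀ {q x y} → ME* q x y → IsVertex q x
ME*-endpoint (inj₁ l) = proj₁ (Link-endpoints l)
ME*-endpoint (inj₂ l) = proj₂ (Link-endpoints l)

data OuterNeighbour : ℕ → ℕ → Fin 3 → Vertex → Set where
  pred-u : ∀ {q} → OuterNeighbour q 0 0F (U (suc q))
  pred-v : ∀ {q m} → OuterNeighbour q (suc m) 0F (V m 2F)
  hub    : ∀ {q m} → OuterNeighbour q m 1F (U (suc m))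
  succ-v : ∀ {q m} → suc m < q → OuterNeighbour q m 2F (V (suc m) 0F)
  succ-u : ∀ {m} → OuterNeighbour (suc m) m 2F (U 0)

triangle-adjacent : ∀ {q m j k} → m < q → j ≢ k → ME* q (V m j) (V m k)
triangle-adjacent {j = 0F} {0F} _   0≢0 = contradiction refl 0≢0
triangle-adjacent {j = 0F} {1F} m<q _   = inj₁ (side₀₁ m<q)
triangle-adjacent {j = 0F} {2F} m<q _   = inj₁ (chord m<q)
triangle-adjacent {j = 1F} {0F} m<q _   = inj₂ (side₀₁ m<q)
triangle-adjacent {j = 1F} {1F} _   1≢1 = contradiction refl 1≢1
triangle-adjacent {j = 1F} {2F} m<q _   = inj₁ (side₁₂ m<q)
triangle-adjacent {j = 2F} {0F} m<q _   = inj₂ (chord m<q)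
triangle-adjacent {j = 2F} {1F} m<q _   = inj₂ (side₁₂ m<q)
triangle-adjacent {j = 2F} {2F} _   2≢2 = contradiction refl 2≢2

triangle-neighbour : ∀ {q m j x} → ME* q (V m j) x → (∃[ k ] j ≢ k × x ≡ V m k) ⊎ OuterNeighbour q m j x
triangle-neighbour (inj₁ (side₀₁ _)) = inj₁ (1F , (λ ()) , refl)
triangle-neighbour (inj₁ (side₁₂ _)) = inj₁ (2F , (λ ()) , refl)
triangle-neighbour (inj₁ (chord _))  = inj₁ (2F , (λ ()) , refl)
triangle-neighbour (inj₁ (hop p))    = inj₂ (succ-v p)
triangle-neighbour (inj₁ leave)      = inj₂ succ-u
triangle-neighbour (inj₂ (enter _))  = inj₂ pred-u
triangle-neighbour (inj₂ (side₀₁ _)) = inj₁ (0F , (λ ()) , refl)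
triangle-neighbour (inj₂ (side₁₂ _)) = inj₁ (1F , (λ ()) , refl)
triangle-neighbour (inj₂ (chord _))  = inj₁ (0F , (λ ()) , refl)
triangle-neighbour (inj₂ (hop _))    = inj₂ pred-v
triangle-neighbour (inj₂ (spoke _))  = inj₂ hub

OuterNeighbour-unique : ∀ {q m j x y} → OuterNeighbour q m j x → OuterNeighbour q m j y → x ≡ y
OuterNeighbour-unique pred-u     pred-u     = refl
OuterNeighbour-unique pred-v     pred-v     = refl
OuterNeighbour-unique hub        hub        = refl
OuterNeighbour-unique (succ-v _) (succ-v _) = refl
OuterNeighbour-unique (succ-v p) succ-u     = contradiction p (<-irrefl refl)
OuterNeighbour-unique succ-u     (succ-v p) = contradiction p (<-irrefl refl)
OuterNeighbour-unique succ-u     succ-u     = refl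

OuterNeighbours-nonadjacent : ∀ {q m j k x y} → 2 ≤ q → j ≢ k →
                              OuterNeighbour q m j x → OuterNeighbour q m k y → ¬ ME* q x y
OuterNeighbours-nonadjacent {j = 0F} {0F} _ 0≢0 _ _ = contradiction refl 0≢0
OuterNeighbours-nonadjacent {j = 1F} {1F} _ 1≢1 _ _ = contradiction refl 1≢1
OuterNeighbours-nonadjacent {j = 2F} {2F} _ 2≢2 _ _ = contradiction refl 2≢2
OuterNeighbours-nonadjacent (s≤s (s≤s _)) _ pred-u     hub        = λ { (inj₁ ()) ; (inj₂ ()) }
OuterNeighbours-nonadjacent (s≤s (s≤s _)) _ pred-v     hub        = λ { (inj₁ ()) ; (inj₂ ()) }
OuterNeighbours-nonadjacent (s≤s (s≤s _)) _ hub        pred-u     = λ { (inj₁ ()) ; (inj₂ ()) }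
OuterNeighbours-nonadjacent (s≤s (s≤s _)) _ hub        pred-v     = λ { (inj₁ ()) ; (inj₂ ()) }
OuterNeighbours-nonadjacent (s≤s (s≤s _)) _ pred-u     (succ-v _) = λ { (inj₁ ()) ; (inj₂ ()) }
OuterNeighbours-nonadjacent (s≤s (s≤s _)) _ pred-v     (succ-v _) = λ { (inj₁ ()) ; (inj₂ ()) }
OuterNeighbours-nonadjacent (s≤s (s≤s _)) _ pred-v     succ-u     = λ { (inj₁ ()) ; (inj₂ ()) }
OuterNeighbours-nonadjacent (s≤s (s≤s _)) _ (succ-v _) pred-u     = λ { (inj₁ ()) ; (inj₂ ()) }
OuterNeighbours-nonadjacent (s≤s (s≤s _)) _ (succ-v _) pred-v     = λ { (inj₁ ()) ; (inj₂ ()) }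
OuterNeighbours-nonadjacent (s≤s (s≤s _)) _ succ-u     pred-v     = λ { (inj₁ ()) ; (inj₂ ()) }
OuterNeighbours-nonadjacent (s≤s (s≤s _)) _ hub        (succ-v _) = λ { (inj₁ ()) ; (inj₂ ()) }
OuterNeighbours-nonadjacent (s≤s (s≤s _)) _ hub        succ-u     = λ { (inj₁ ()) ; (inj₂ ()) }
OuterNeighbours-nonadjacent (s≤s (s≤s _)) _ (succ-v _) hub        = λ { (inj₁ ()) ; (inj₂ ()) }
OuterNeighbours-nonadjacent (s≤s (s≤s _)) _ succ-u     hub        = λ { (inj₁ ()) ; (inj₂ ()) }

triangle-not-on-induced-four-cycle : ∀ {q m j b c d} → 2 ≤ q → ¬ InducedFourCycle (ME* q) (V m j) b c d
triangle-not-on-induced-four-cycle 2≤q sq =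
  clique-not-on-induced-four-cycle ME*-sym Fin._≟_ (V _) (OuterNeighbour _ _)
    (triangle-adjacent (ME*-endpoint (FourCycle.ab (InducedFourCycle.cycle sq))))
    triangle-neighbour OuterNeighbour-unique (OuterNeighbours-nonadjacent 2≤q) sq

ME*-U⇒Cyclic : ∀ {q i j} → ME* q (U i) (U j) → Cyclic (suc q) i j
ME*-U⇒Cyclic (inj₁ (ascend _)) = step up
ME*-U⇒Cyclic (inj₁ extra)      = wrap
ME*-U⇒Cyclic (inj₂ (ascend _)) = step down
ME*-U⇒Cyclic (inj₂ extra)      = unwrap

ME*-induced-four-cycle-free : ∀ {q a b c d} → 3 ≤ q → ¬ InducedFourCycle (ME* q) a b c d
ME*-induced-four-cycle-free {a = V _ _} 3≤q =
  triangle-not-on-induced-four-cycle (<⇒≤ 3≤q)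
ME*-induced-four-cycle-free {a = U _} {V _ _} 3≤q =
  triangle-not-on-induced-four-cycle (<⇒≤ 3≤q) ∘ rotate-induced ME*-sym
ME*-induced-four-cycle-free {a = U _} {U _} {V _ _} 3≤q =
  triangle-not-on-induced-four-cycle (<⇒≤ 3≤q) ∘ rotate-induced ME*-sym ∘ rotate-induced ME*-sym
ME*-induced-four-cycle-free {a = U _} {U _} {U _} {V _ _} 3≤q =
  triangle-not-on-induced-four-cycle (<⇒≤ 3≤q)
    ∘ rotate-induced ME*-sym ∘ rotate-induced ME*-sym ∘ rotate-induced ME*-sym
ME*-induced-four-cycle-free {a = U _} {U _} {U _} {U _} 3≤q =
  cycle-four-cycle-free (s≤s 3≤q) ∘ preimage U ME*-U⇒Cyclic ∘ InducedFourCycle.cycle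

-- The numbering of the vertices by 0, …, 4q+1

code : ℕ → Vertex → ℕ
code q (U i)   = u q i
code q (V m j) = v q (suc m) (suc (toℕ j))

triangle-vertex : ℕ → Vertex
triangle-vertex r = V (r / 3) (r mod 3)

decode : ℕ → ℕ → Vertex
decode q a with a ≤? suc q
... | yes _ = U a
... | no  _ = triangle-vertex (a ∸ (q + 2))

private
  order-split : ∀ q → 4 * q + 2 ≡ q * 3 + (q + 2)
  order-split = solve-∀

  entry-code : ∀ q → q + 2 + 3 * 0 + 0 ≡ suc (suc q)
  entry-code = solve-∀

  hop-code : ∀ q m → q + 2 + 3 * suc m + 0 ≡ suc (q + 2 + 3 * m + 2)
  hop-code = solve-∀

  last-code : ∀ m → suc (suc m + 2 + 3 * m + 2) ≡ 4 * suc m + 2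
  last-code = solve-∀

  next-triangle-code : ∀ q m → q + 2 + 3 * m + 3 ≡ q + 2 + 3 * suc m
  next-triangle-code = solve-∀

  all-triangles-code : ∀ q → q + 2 + 3 * q ≡ 4 * q + 2
  all-triangles-code = solve-∀

  1+q<q+2+r : ∀ q r → suc q < q + 2 + r
  1+q<q+2+r q r = subst (_≤ q + 2 + r) (+-comm q 2) (m≤m+n (q + 2) r)

  ≰1+q⇒q+2≤ : ∀ {q a} → ¬ a ≤ suc q → q + 2 ≤ a
  ≰1+q⇒q+2≤ {q} {a} a≰1+q = subst (_≤ a) (+-comm 2 q) (≰⇒> a≰1+q)

3*[r/3]+r%3≡r : ∀ r → 3 * (r / 3) + toℕ (r mod 3) ≡ r
3*[r/3]+r%3≡r r = begin
  3 * (r / 3) + toℕ (r mod 3)  ≡⟨ +-comm (3 * (r / 3)) _ ⟩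
  toℕ (r mod 3) + 3 * (r / 3)  ≡⟨ cong (toℕ (r mod 3) +_) (*-comm 3 (r / 3)) ⟩
  toℕ (r mod 3) + r / 3 * 3    ≡⟨ DivMod.property (r divMod 3) ⟨
  r                            ∎
  where open ≡-Reasoning

triangle-vertex-inverse : ∀ m j → triangle-vertex (3 * m + toℕ j) ≡ V m j
triangle-vertex-inverse m j = cong₂ V quotient remainder
  where
  open ≡-Reasoning

  3∣3m : 3 ∣ 3 * m
  3∣3m = m∣m*n m

  quotient : (3 * m + toℕ j) / 3 ≡ m
  quotient = begin
    (3 * m + toℕ j) / 3    ≡⟨ +-distrib-/-∣ˡ (toℕ j) 3∣3m ⟩
    3 * m / 3 + toℕ j / 3  ≡⟨ cong₂ _+_ (trans (cong (_/ 3) (*-comm 3 m)) (m*n/n≡m m 3))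
                                        (m<n⇒m/n≡0 (toℕ<n j)) ⟩
    m + 0                  ≡⟨ +-identityʳ m ⟩
    m                      ∎

  remainder : (3 * m + toℕ j) mod 3 ≡ j
  remainder = toℕ-injective (begin
    toℕ ((3 * m + toℕ j) mod 3)  ≡⟨ toℕ-fromℕ< _ ⟩
    (3 * m + toℕ j) % 3          ≡⟨ %-remove-+ˡ (toℕ j) 3∣3m ⟩
    toℕ j % 3                    ≡⟨ m<n⇒m%n≡m (toℕ<n j) ⟩
    toℕ j                        ∎)

code-triangle-vertex : ∀ q r → code q (triangle-vertex r) ≡ q + 2 + r
code-triangle-vertex q r = trans (+-assoc (q + 2) _ _) (cong (q + 2 +_) (3*[r/3]+r%3≡r r))

code-decode : ∀ q a → code q (decode q a) ≡ a
code-decode q a with a ≤? suc q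
... | yes _     = refl
... | no a≰1+q = trans (code-triangle-vertex q _) (m+[n∸m]≡n (≰1+q⇒q+2≤ a≰1+q))

decode-U : ∀ {q i} → i ≤ suc q → decode q i ≡ U i
decode-U {q} {i} i≤1+q with i ≤? suc q
... | yes _     = refl
... | no i≰1+q = contradiction i≤1+q i≰1+q

decode-triangle : ∀ q r → decode q (q + 2 + r) ≡ triangle-vertex r
decode-triangle q r with q + 2 + r ≤? suc q
... | yes ≤1+q = contradiction ≤1+q (<⇒≱ (1+q<q+2+r q r))
... | no _     = cong triangle-vertex (m+n∸m≡n (q + 2) r)

decode-code : ∀ {q x} → IsVertex q x → decode q (code q x) ≡ x
decode-code {x = U _} i≤1+q = decode-U i≤1+q
decode-code {q} {V m j} _ = begin
  decode q (q + 2 + 3 * m + toℕ j)    ≡⟨ cong (decode q) (+-assoc (q + 2) (3 * m) (toℕ j)) ⟩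
  decode q (q + 2 + (3 * m + toℕ j))  ≡⟨ decode-triangle q _ ⟩
  triangle-vertex (3 * m + toℕ j)     ≡⟨ triangle-vertex-inverse m j ⟩
  V m j                               ∎
  where open ≡-Reasoning

decode-IsVertex : ∀ {q a} → a < order q → IsVertex q (decode q a)
decode-IsVertex {q} {a} a<order with a ≤? suc q
... | yes a≤1+q = a≤1+q
... | no a≰1+q  = m<n*o⇒m/o<n (begin-strict
  a ∸ (q + 2)                <⟨ ∸-monoˡ-< a<order (≰1+q⇒q+2≤ a≰1+q) ⟩
  4 * q + 2 ∸ (q + 2)        ≡⟨ cong (_∸ (q + 2)) (order-split q) ⟩
  q * 3 + (q + 2) ∸ (q + 2)  ≡⟨ m+n∸n≡m (q * 3) (q + 2) ⟩
  q * 3                      ∎)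
  where open ≤-Reasoning

code-bound : ∀ {q x} → IsVertex q x → code q x < order q
code-bound {q} {U i} i≤1+q = begin-strict
  i          ≤⟨ i≤1+q ⟩
  suc q      <⟨ n<1+n (suc q) ⟩
  2 + q      ≡⟨ +-comm 2 q ⟩
  q + 2      ≤⟨ +-monoˡ-≤ 2 (m≤n*m q 4) ⟩
  4 * q + 2  ∎
  where open ≤-Reasoning
code-bound {q} {V m j} m<q = begin-strict
  q + 2 + 3 * m + toℕ j  <⟨ +-monoʳ-< (q + 2 + 3 * m) (toℕ<n j) ⟩
  q + 2 + 3 * m + 3      ≡⟨ next-triangle-code q m ⟩
  q + 2 + 3 * suc m      ≤⟨ +-monoʳ-≤ (q + 2) (*-monoʳ-≤ 3 m<q) ⟩
  q + 2 + 3 * q          ≡⟨ all-triangles-code q ⟩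
  4 * q + 2              ∎
  where open ≤-Reasoning

successor : ∀ {q x} → IsVertex q x → suc (code q x) < order q →
            ∃[ y ] Link q x y × code q y ≡ suc (code q x)
successor {q} {U i} i≤1+q bound with m≤n⇒m<n∨m≡n i≤1+q
... | inj₁ (s≤s i≤q) = U (suc i) , ascend i≤q , refl
... | inj₂ refl      = V 0 0F , enter (positive q bound) , entry-code q
  where
  positive : ∀ q → suc (suc (suc q)) ≤ 4 * q + 2 → 0 < q
  positive zero    (s≤s (s≤s ()))
  positive (suc _) _ = s≤s z≤n
successor {x = V m 0F} m<q _ = V m 1F , side₀₁ m<q , +-suc _ 0
successor {x = V m 1F} m<q _ = V m 2F , side₁₂ m<q , +-suc _ 1
successor {q} {V m 2F} m<q bound with m≤n⇒m<n∨m≡n m<q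
... | inj₁ 1+m<q = V (suc m) 0F , hop 1+m<q , hop-code q m
... | inj₂ refl  = contradiction bound (<-irrefl (last-code m))

consecutive-edge : ∀ {q x y} → Link q x y → code q y ≡ suc (code q x) → Edge q (code q x) (code q y)
consecutive-edge {q} {x} l y≡1+x =
  subst (Edge q (code q x)) (sym y≡1+x)
        (cyc (code q x) (subst (_< order q) y≡1+x (code-bound (proj₂ (Link-endpoints l)))))

link-edge : ∀ {q x y} → Link q x y → Edge q (code q x) (code q y)
link-edge l@(ascend _) = consecutive-edge l refl
link-edge l@(enter _)  = consecutive-edge l (entry-code _)
link-edge l@(side₀₁ _) = consecutive-edge l (+-suc _ 0)
link-edge l@(side₁₂ _) = consecutive-edge l (+-suc _ 1)
link-edge l@(hop _)    = consecutive-edge l (hop-code _ _)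
link-edge leave        = close
link-edge (spoke m<q)  = spoke (suc _) (s≤s z≤n) m<q
link-edge (chord m<q)  = chord (suc _) (s≤s z≤n) m<q
link-edge extra        = extra

decode-link : ∀ {q x y} → Link q x y → Link q (decode q (code q x)) (decode q (code q y))
decode-link l = subst₂ (Link _) (sym (decode-code x∈)) (sym (decode-code y∈)) l
  where
  x∈ = proj₁ (Link-endpoints l)
  y∈ = proj₂ (Link-endpoints l)

decode-consecutive : ∀ {q k} → suc k < order q → Link q (decode q k) (decode q (suc k))
decode-consecutive {q} {k} 1+k<order
  with successor (decode-IsVertex (<-trans (n<1+n k) 1+k<order))
                 (subst (λ n → suc n < order q) (sym (code-decode q k)) 1+k<order)
... | y , l , y≡1+k = subst (Link q (decode q k)) (sym decode-1+k) l
  where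
  open ≡-Reasoning
  decode-1+k : decode q (suc k) ≡ y
  decode-1+k = begin
    decode q (suc k)                      ≡⟨ cong (decode q ∘ suc) (code-decode q k) ⟨
    decode q (suc (code q (decode q k)))  ≡⟨ cong (decode q) y≡1+k ⟨
    decode q (code q y)                   ≡⟨ decode-code (proj₂ (Link-endpoints l)) ⟩
    y                                     ∎

edge-link : ∀ {q a b} → 0 < q → Edge q a b → Link q (decode q a) (decode q b)
edge-link _         (cyc _ 1+k<order)     = decode-consecutive 1+k<order
edge-link (s≤s z≤n) close                 = decode-link leave
edge-link _         (spoke (suc _) _ m<q) = decode-link (spoke m<q)
edge-link _         (chord (suc _) _ m<q) = decode-link (chord m<q)
edge-link _         extra                 = decode-link extra

decode-injective : ∀ {q} → Injective _≡_ _≡_ (decode q)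
decode-injective {q} {a} {b} da≡db = begin
  a                    ≡⟨ code-decode q a ⟨
  code q (decode q a)  ≡⟨ cong (code q) da≡db ⟩
  code q (decode q b)  ≡⟨ code-decode q b ⟩
  b                    ∎
  where open ≡-Reasoning

decode-preserves : ∀ {q a b} → 0 < q → Adj q a b → ME* q (decode q a) (decode q b)
decode-preserves 0<q = Sum.map (edge-link 0<q) (edge-link 0<q)

decode-reflects : ∀ {q a b} → ME* q (decode q a) (decode q b) → Adj q a b
decode-reflects = Sum.map decoded-edge decoded-edge
  where
  decoded-edge : ∀ {q a b} → Link q (decode q a) (decode q b) → Edge q a b
  decoded-edge {q} {a} {b} l = subst₂ (Edge q) (code-decode q a) (code-decode q b) (link-edge l)

InducedC4⇒InducedFourCycle : ∀ {q} (C : InducedC4 q) →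
  InducedFourCycle (Adj q) (InducedC4.a C) (InducedC4.b C) (InducedC4.c C) (InducedC4.d C)
InducedC4⇒InducedFourCycle C = induced (four-cycle ab bc cd da a≢c b≢d) ¬ac ¬bd
  where open InducedC4 C

theorem6 : ∀ (q : ℕ) → 3 ≤ q → C4-free q
theorem6 q 3≤q C =
  ME*-induced-four-cycle-free 3≤q
    (image (decode q) decode-injective (decode-preserves 0<q) decode-reflects
           (InducedC4⇒InducedFourCycle C))
  where
  0<q : 0 < q
  0<q = ≤-trans (s≤s z≤n) 3≤q
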